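{- Let $A$ be an $n\times n$ real symmetric matrix such that $A[\alpha]$ is invertible for some $\alpha \subseteq \{1,\dots,n\}$. Then for any $i \notin \alpha$, the matrices $A$ and $A/A[\alpha]$ have the same $i$-nullity pair.
   Context: $A[\alpha]$ is the principal submatrix of $A$ on rows and columns in $\alpha$. Writing (after permuting so $\alpha$ comes first) $A = \begin{bmatrix} Q & B^\top \\ B & C\end{bmatrix}$ with $Q = A[\alpha]$ invertible, the Schur complement is $A/Q = C - BQ^{ -1}B^\top$, whose rows and columns are indexed by $\{1,\dots,n\}\setminus\alpha$. For a symmetric matrix $M$ and an index $i$ of $M$, $M(i)$ is $M$ with row and column $i$ deleted, and the $i$-nullity pair of $M$ is $(\operatorname{null}(M),\operatorname{null}(M(i)))$. -}

module Defs where

open import Level using (Level; _⊔_) renaming (suc to lsuc)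
open import Data.Nat using (ℕ; zero; suc)
open import Data.Fin using (Fin; zero; suc)
open import Data.Fin.Subset using (Subset; _∈_; inside; outside)
open import Data.Vec using (lookup)
open import Data.Bool using (if_then_else_)
open import Data.Product using (Σ; ∃; _×_)
open import Relation.Nullary using (¬_)
open import Algebra.Bundles using (CommutativeRing)

record Field (c ℓ : Level) : Set (lsuc (c ⊔ ℓ)) where
  field
    commutativeRing : CommutativeRing c ℓ
  open CommutativeRing commutativeRing public
  field
    0≉1     : ¬ (0# ≈ 1#)
    inverse : ∀ x → ¬ (x ≈ 0#) → ∃ λ y → x * y ≈ 1#

module _ {c ℓ : Level} (F : Field c ℓ) where
  open Field F using (Carrier; _≈_; _+_; _*_; _-_; 0#; 1#)

  Mat : ℕ → Set c
  Mat n = Fin n → Fin n → Carrier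

  Vect : ℕ → Set c
  Vect n = Fin n → Carrier

  sum : ∀ {n} → (Fin n → Carrier) → Carrier
  sum {zero}  f = 0#
  sum {suc n} f = f zero + sum (λ j → f (suc j))

  sumOn : ∀ {n} → Subset n → (Fin n → Carrier) → Carrier
  sumOn β f = sum (λ j → if lookup β j then f j else 0#)

  Symmetric : ∀ {n} → Mat n → Set ℓ
  Symmetric A = ∀ i j → A i j ≈ A j i

  δ : ∀ {n} → Fin n → Fin n → Carrier
  δ zero    zero    = 1#
  δ zero    (suc j) = 0#
  δ (suc i) zero    = 0#
  δ (suc i) (suc j) = δ i j

  IsInverseOfPrincipal : ∀ {n} → Subset n → Mat n → Mat n → Set ℓ
  IsInverseOfPrincipal α A P =
    (∀ i j → i ∈ α → j ∈ α → sumOn α (λ k → A i k * P k j) ≈ δ i j) ×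
    (∀ i j → i ∈ α → j ∈ α → sumOn α (λ k → P i k * A k j) ≈ δ i j)

  PrincipalInvertible : ∀ {n} → Subset n → Mat n → Set (c ⊔ ℓ)
  PrincipalInvertible {n} α A = Σ (Mat n) (IsInverseOfPrincipal α A)

  -- Schur complement A / A[α] = C - B Q⁻¹ Bᵀ, where P = Q⁻¹ = A[α]⁻¹.
  -- Only the entries with row and column in ∁ α are meaningful; it is
  -- always used together with the index set ∁ α.
  schur : ∀ {n} → Subset n → Mat n → Mat n → Mat n
  schur α A P i j =
    A i j - sumOn α (λ k → sumOn α (λ l → A i k * (P k l * A l j)))

  InKernel : ∀ {n} → Subset n → Mat n → Vect n → Set ℓ
  InKernel β M x = ∀ i → i ∈ β → sumOn β (λ j → M i j * x j) ≈ 0#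

  HasNullity : ∀ {n} → Subset n → Mat n → ℕ → Set (c ⊔ ℓ)
  HasNullity {n} β M k = Σ (Fin k → Vect n) λ v →
    (∀ t → InKernel β M (v t)) ×
    (∀ (a : Fin k → Carrier) →
       (∀ j → j ∈ β → sum (λ t → a t * v t j) ≈ 0#) → ∀ t → a t ≈ 0#) ×
    (∀ x → InKernel β M x →
       ∃ λ (a : Fin k → Carrier) → ∀ j → j ∈ β → x j ≈ sum (λ t → a t * v t j))

{-# OPTIONS --safe #-}
module Submission where

open import Defs
open import Level using (Level; _⊔_)
open import Data.Nat using (ℕ; zero; suc)
open import Data.Fin using (Fin; zero; suc)
open import Data.Fin.Subset using (Subset; ⊤; ∁; _-_; _∉_)
open import Data.Fin.Subset using (_∈_; _⊆_; inside; outside; ⊥; _─_)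
open import Data.Fin.Subset.Properties using (p─⊥≡p)
open import Data.Product using (_×_; ∃; _,_; proj₁; proj₂)
open import Data.Sum as Sum using (_⊎_; inj₁; inj₂)
open import Data.Bool using (Bool; true; false; if_then_else_)
open import Data.Vec using (lookup; _∷_; here; there)
open import Data.Vec.Properties using (lookup⇒[]=; []=⇒lookup)
open import Function.Bundles using (_⇔_; mk⇔)
open import Relation.Binary.PropositionalEquality as ≡ using (_≡_)
open import Relation.Nullary using (contradiction)
open import Function using (_∘_)

-- Write x = (x_α, x_γ) for a vector on β = α ⊍ γ and Q = A[α].  The α-rows of
-- A[β] x = 0 say Q x_α + A[α,γ] x_γ = 0, so x_α = - Q⁻¹ A[α,γ] x_γ is
-- determined by x_γ; substituting it into the γ-rows turns them into
-- (A/Q) x_γ = 0.  Conversely every y ∈ ker (A/Q) extends to a kernel vector of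
-- A[β] by x_α := - Q⁻¹ A[α,γ] y.  Hence restriction to γ is a linear bijection
-- ker A[β] → ker (A/Q)[γ], and the nullities agree.  The theorem is the cases
-- β = {1,…,n} and β = {1,…,n} ∖ {i}.

data DisjointUnionAt : (b a g : Bool) → Set where
  left  : DisjointUnionAt true true false
  right : DisjointUnionAt true false true
  none  : DisjointUnionAt false false false

infix 4 _≐_⊍_
record _≐_⊍_ {n} (β α γ : Subset n) : Set where
  field
    at : ∀ j → DisjointUnionAt (lookup β j) (lookup α j) (lookup γ j)
open _≐_⊍_

module _ {n} {β α γ : Subset n} (β≐α⊍γ : β ≐ α ⊍ γ) where

  ⊍-⊆ˡ : α ⊆ β
  ⊍-⊆ˡ {j} j∈α = lookup⇒[]= j β (go (β≐α⊍γ .at j) ([]=⇒lookup j∈α))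
    where
    go : ∀ {b a g} → DisjointUnionAt b a g → a ≡ true → b ≡ true
    go left _ = ≡.refl

  ⊍-⊆ʳ : γ ⊆ β
  ⊍-⊆ʳ {j} j∈γ = lookup⇒[]= j β (go (β≐α⊍γ .at j) ([]=⇒lookup j∈γ))
    where
    go : ∀ {b a g} → DisjointUnionAt b a g → g ≡ true → b ≡ true
    go right _ = ≡.refl

  ⊍-disjoint : ∀ {j} → j ∈ γ → lookup α j ≡ false
  ⊍-disjoint {j} j∈γ = go (β≐α⊍γ .at j) ([]=⇒lookup j∈γ)
    where
    go : ∀ {b a g} → DisjointUnionAt b a g → g ≡ true → a ≡ false
    go right _ = ≡.refl

  ⊍-∈ : ∀ {j} → j ∈ β → j ∈ α ⊎ j ∈ γ
  ⊍-∈ {j} j∈β =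
    Sum.map (lookup⇒[]= j α) (lookup⇒[]= j γ) (go (β≐α⊍γ .at j) ([]=⇒lookup j∈β))
    where
    go : ∀ {b a g} → DisjointUnionAt b a g → b ≡ true → a ≡ true ⊎ g ≡ true
    go left  _ = inj₁ ≡.refl
    go right _ = inj₂ ≡.refl

⊤≐⊍∁ : ∀ {n} (α : Subset n) → ⊤ ≐ α ⊍ ∁ α
⊤≐⊍∁ (inside  ∷ α) .at zero    = left
⊤≐⊍∁ (outside ∷ α) .at zero    = right
⊤≐⊍∁ (_       ∷ α) .at (suc j) = ⊤≐⊍∁ α .at j

-- `_─_` is built from a where-bound `diff` that abstracts over both arguments,
-- so `rewrite` cannot find `β ─ ⊥` inside `(b ∷ β) - zero`; going through this
-- lemma lets conversion checking identify the two.
⊍-─⊥ : ∀ {n} {β α γ : Subset n} → β ≐ α ⊍ γ → β ─ ⊥ ≐ α ⊍ (γ ─ ⊥)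
⊍-─⊥ {β = β} {γ = γ} d rewrite p─⊥≡p β | p─⊥≡p γ = d

⊍-remove : ∀ {n} {β α γ : Subset n} i → β ≐ α ⊍ γ → i ∉ α → β - i ≐ α ⊍ (γ - i)
⊍-remove {β = _ ∷ _} {outside ∷ _} {_ ∷ _} zero _ _ .at zero = none
⊍-remove {β = _ ∷ _} {inside  ∷ _} {_ ∷ _} zero _ i∉α .at zero = contradiction here i∉α
⊍-remove {β = _ ∷ β} {_ ∷ α} {_ ∷ γ} zero d _ .at (suc j) =
  ⊍-─⊥ {β = β} {α} {γ} (record { at = λ j → d .at (suc j) }) .at j
⊍-remove {β = _ ∷ _} {_ ∷ _} {_ ∷ _} (suc i) d _ .at zero = d .at zero
⊍-remove {β = _ ∷ β} {_ ∷ α} {_ ∷ γ} (suc i) d i∉α .at (suc j) =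
  ⊍-remove {β = β} {α} {γ} i (record { at = λ j → d .at (suc j) }) (i∉α ∘ there) .at j

module _ {c ℓ : Level} (F : Field c ℓ) where
  open Field F hiding (_-_; zero)
  open import Algebra.Properties.Semiring.Sum semiring
    using (sum-cong-≋; sum-replicate-zero; ∑-distrib-+; ∑-comm; *-distribˡ-sum)
    renaming (sum to ∑)
  open import Algebra.Properties.Ring ring
    using ( -1*x≈-x; -0#≈0#; -‿distribʳ-*; -‿involutive; -‿injective
          ; +-inverseʳ-unique; [y-z]x≈yx-zx)
  open import Algebra.Properties.CommutativeSemigroup *-commutativeSemigroup
    using (x∙yz≈y∙xz)
  open import Relation.Binary.Reasoning.Setoid setoid

  sum≡∑ : ∀ {n} (f : Fin n → Carrier) → sum F f ≡ ∑ f
  sum≡∑ {zero}  f = ≡.refl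
  sum≡∑ {suc n} f = ≡.cong (f zero +_) (sum≡∑ (λ j → f (suc j)))

  sum-cong : ∀ {n} {f g : Fin n → Carrier} → (∀ j → f j ≈ g j) → sum F f ≈ sum F g
  sum-cong {f = f} {g} f≈g = begin
    sum F f ≡⟨ sum≡∑ f ⟩
    ∑ f     ≈⟨ sum-cong-≋ f≈g ⟩
    ∑ g     ≡⟨ sum≡∑ g ⟨
    sum F g ∎

  sum-zero : ∀ n → sum F {n} (λ _ → 0#) ≈ 0#
  sum-zero n = trans (reflexive (sum≡∑ {n} _)) (sum-replicate-zero n)

  sum-+ : ∀ {n} (f g : Fin n → Carrier) → sum F (λ j → f j + g j) ≈ sum F f + sum F g
  sum-+ f g = begin
    sum F (λ j → f j + g j) ≡⟨ sum≡∑ (λ j → f j + g j) ⟩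
    ∑ (λ j → f j + g j)     ≈⟨ ∑-distrib-+ f g ⟩
    ∑ f + ∑ g               ≡⟨ ≡.cong₂ _+_ (sum≡∑ f) (sum≡∑ g) ⟨
    sum F f + sum F g       ∎

  sum-*ˡ : ∀ {n} x (f : Fin n → Carrier) → x * sum F f ≈ sum F (λ j → x * f j)
  sum-*ˡ x f = begin
    x * sum F f          ≡⟨ ≡.cong (x *_) (sum≡∑ f) ⟩
    x * ∑ f              ≈⟨ *-distribˡ-sum x f ⟩
    ∑ (λ j → x * f j)    ≡⟨ sum≡∑ (λ j → x * f j) ⟨
    sum F (λ j → x * f j) ∎

  sum-comm : ∀ {m n} (f : Fin m → Fin n → Carrier) →
    sum F (λ i → sum F (λ j → f i j)) ≈ sum F (λ j → sum F (λ i → f i j))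
  sum-comm f = begin
    sum F (λ i → sum F (λ j → f i j)) ≈⟨ sum-cong (λ i → reflexive (sum≡∑ (f i))) ⟩
    sum F (λ i → ∑ (λ j → f i j))     ≡⟨ sum≡∑ (λ i → ∑ (f i)) ⟩
    ∑ (λ i → ∑ (λ j → f i j))         ≈⟨ ∑-comm f ⟩
    ∑ (λ j → ∑ (λ i → f i j))         ≡⟨ sum≡∑ (λ j → ∑ (λ i → f i j)) ⟨
    sum F (λ j → ∑ (λ i → f i j))     ≈⟨ sum-cong (λ j → reflexive (sum≡∑ (λ i → f i j))) ⟨
    sum F (λ j → sum F (λ i → f i j)) ∎

  sum-neg : ∀ {n} (f : Fin n → Carrier) → sum F (λ j → - f j) ≈ - sum F f
  sum-neg f = begin
    sum F (λ j → - f j)     ≈⟨ sum-cong (λ j → -1*x≈-x (f j)) ⟨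
    sum F (λ j → - 1# * f j) ≈⟨ sum-*ˡ (- 1#) f ⟨
    - 1# * sum F f          ≈⟨ -1*x≈-x _ ⟩
    - sum F f               ∎

  sum-δ : ∀ {n} (k : Fin n) (h : Fin n → Carrier) → sum F (λ j → δ F k j * h j) ≈ h k
  sum-δ {suc n} zero h = begin
    1# * h zero + sum F (λ j → 0# * h (suc j))
      ≈⟨ +-cong (*-identityˡ _) (trans (sum-cong {n} (λ j → zeroˡ _)) (sum-zero n)) ⟩
    h zero + 0#  ≈⟨ +-identityʳ _ ⟩
    h zero       ∎
  sum-δ {suc n} (suc k) h = begin
    0# * h zero + sum F (λ j → δ F k j * h (suc j))
      ≈⟨ +-cong (zeroˡ _) (sum-δ k (λ j → h (suc j))) ⟩
    0# + h (suc k) ≈⟨ +-identityˡ _ ⟩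
    h (suc k)      ∎

  mask : Bool → Carrier → Carrier
  mask b x = if b then x else 0#

  mask-cong : ∀ b {x y} → (b ≡ true → x ≈ y) → mask b x ≈ mask b y
  mask-cong true  x≈y = x≈y ≡.refl
  mask-cong false _   = refl

  mask-zero : ∀ b → mask b 0# ≈ 0#
  mask-zero true  = refl
  mask-zero false = refl

  mask-commute : (φ : Carrier → Carrier) → φ 0# ≈ 0# →
    ∀ b x → mask b (φ x) ≈ φ (mask b x)
  mask-commute φ φ0≈0 true  x = refl
  mask-commute φ φ0≈0 false x = sym φ0≈0

  mask-+ : ∀ b x y → mask b (x + y) ≈ mask b x + mask b y
  mask-+ true  x y = refl
  mask-+ false x y = sym (+-identityˡ 0#)

  mask-sum : ∀ {m} b (h : Fin m → Carrier) →
    mask b (sum F h) ≈ sum F (λ t → mask b (h t))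
  mask-sum         true  h = refl
  mask-sum {m = m} false h = sym (sum-zero m)

  mask-⊍ : ∀ {b a g} → DisjointUnionAt b a g → ∀ x → mask b x ≈ mask a x + mask g x
  mask-⊍ left  x = sym (+-identityʳ x)
  mask-⊍ right x = sym (+-identityˡ x)
  mask-⊍ none  x = sym (+-identityˡ 0#)

  module _ {n : ℕ} where

    sumOn-cong : ∀ (β : Subset n) {f g} → (∀ j → j ∈ β → f j ≈ g j) →
      sumOn F β f ≈ sumOn F β g
    sumOn-cong β f≈g =
      sum-cong (λ j → mask-cong (lookup β j) (λ j∈β → f≈g j (lookup⇒[]= j β j∈β)))

    sumOn-zero : ∀ (β : Subset n) → sumOn F β (λ _ → 0#) ≈ 0#
    sumOn-zero β = trans (sum-cong (λ j → mask-zero (lookup β j))) (sum-zero n)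

    sumOn-+ : ∀ (β : Subset n) f g →
      sumOn F β (λ j → f j + g j) ≈ sumOn F β f + sumOn F β g
    sumOn-+ β f g =
      trans (sum-cong (λ j → mask-+ (lookup β j) (f j) (g j))) (sum-+ {n} _ _)

    sumOn-neg : ∀ (β : Subset n) f → sumOn F β (λ j → - f j) ≈ - sumOn F β f
    sumOn-neg β f =
      trans (sum-cong (λ j → mask-commute -_ -0#≈0# (lookup β j) (f j))) (sum-neg {n} _)

    sumOn-*ˡ : ∀ (β : Subset n) x f → x * sumOn F β f ≈ sumOn F β (λ j → x * f j)
    sumOn-*ˡ β x f = trans (sum-*ˡ x (λ j → mask (lookup β j) (f j)))
      (sum-cong (λ j → sym (mask-commute (x *_) (zeroʳ x) (lookup β j) (f j))))

    sumOn-*ʳ : ∀ (β : Subset n) x f → sumOn F β f * x ≈ sumOn F β (λ j → f j * x)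
    sumOn-*ʳ β x f = begin
      sumOn F β f * x            ≈⟨ *-comm _ x ⟩
      x * sumOn F β f            ≈⟨ sumOn-*ˡ β x f ⟩
      sumOn F β (λ j → x * f j)  ≈⟨ sumOn-cong β (λ j _ → *-comm x (f j)) ⟩
      sumOn F β (λ j → f j * x)  ∎

    sum-sumOn-comm : ∀ {m} (β : Subset n) (f : Fin m → Fin n → Carrier) →
      sum F (λ t → sumOn F β (λ j → f t j)) ≈ sumOn F β (λ j → sum F (λ t → f t j))
    sum-sumOn-comm β f = trans (sum-comm (λ t j → mask (lookup β j) (f t j)))
      (sum-cong (λ j → sym (mask-sum (lookup β j) (λ t → f t j))))

    sumOn-comm : ∀ (α γ : Subset n) (f : Fin n → Fin n → Carrier) →
      sumOn F α (λ k → sumOn F γ (λ j → f k j)) ≈ sumOn F γ (λ j → sumOn F α (λ k → f k j))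
    sumOn-comm α γ f = begin
      sumOn F α (λ k → sumOn F γ (λ j → f k j))
        ≈⟨ sum-cong (λ k → mask-sum {n} (lookup α k) _) ⟩
      sum F (λ k → sum F (λ j → mask (lookup α k) (mask (lookup γ j) (f k j))))
        ≈⟨ sum-cong (λ k → sum-cong (λ j →
             mask-commute (mask (lookup γ j)) (mask-zero (lookup γ j)) (lookup α k) _)) ⟩
      sum F (λ k → sumOn F γ (λ j → mask (lookup α k) (f k j)))
        ≈⟨ sum-sumOn-comm γ (λ k j → mask (lookup α k) (f k j)) ⟩
      sumOn F γ (λ j → sumOn F α (λ k → f k j)) ∎

    sumOn-⊍ : ∀ {β α γ : Subset n} → β ≐ α ⊍ γ →
      ∀ f → sumOn F β f ≈ sumOn F α f + sumOn F γ f
    sumOn-⊍ β≐α⊍γ f = trans (sum-cong (λ j → mask-⊍ (β≐α⊍γ .at j) (f j))) (sum-+ {n} _ _)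

    sumOn-δ : ∀ (β : Subset n) {k} (x : Fin n → Carrier) → k ∈ β →
      sumOn F β (λ j → δ F k j * x j) ≈ x k
    sumOn-δ β {k} x k∈β = begin
      sumOn F β (λ j → δ F k j * x j)
        ≈⟨ sum-cong (λ j → mask-commute (δ F k j *_) (zeroʳ _) (lookup β j) (x j)) ⟩
      sum F (λ j → δ F k j * mask (lookup β j) (x j))
        ≈⟨ sum-δ k _ ⟩
      mask (lookup β k) (x k)
        ≡⟨ ≡.cong (λ b → mask b (x k)) ([]=⇒lookup k∈β) ⟩
      x k ∎

  module _ {n : ℕ} where

    infixr 7 _·[_]_ _∘[_]_

    _·[_]_ : Mat F n → Subset n → Vect F n → Vect F n
    (M ·[ β ] x) r = sumOn F β (λ j → M r j * x j)

    _∘[_]_ : Mat F n → Subset n → Mat F n → Mat F n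
    (M ∘[ α ] N) i j = sumOn F α (λ k → M i k * N k j)

    ·-congʳ : ∀ (M : Mat F n) β {x y} → (∀ j → j ∈ β → x j ≈ y j) →
      ∀ r → (M ·[ β ] x) r ≈ (M ·[ β ] y) r
    ·-congʳ M β x≈y r = sumOn-cong β (λ j j∈β → *-congˡ (x≈y j j∈β))

    ·-neg : ∀ (M : Mat F n) β x r → (M ·[ β ] (λ j → - x j)) r ≈ - (M ·[ β ] x) r
    ·-neg M β x r = trans (sumOn-cong β (λ j _ → sym (-‿distribʳ-* _ _))) (sumOn-neg β _)

    ·-assoc : ∀ (M N : Mat F n) α γ x r →
      (M ·[ α ] N ·[ γ ] x) r ≈ ((M ∘[ α ] N) ·[ γ ] x) r
    ·-assoc M N α γ x r = begin
      sumOn F α (λ k → M r k * sumOn F γ (λ j → N k j * x j))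
        ≈⟨ sumOn-cong α (λ k _ → sumOn-*ˡ γ (M r k) _) ⟩
      sumOn F α (λ k → sumOn F γ (λ j → M r k * (N k j * x j)))
        ≈⟨ sumOn-comm α γ _ ⟩
      sumOn F γ (λ j → sumOn F α (λ k → M r k * (N k j * x j)))
        ≈⟨ sumOn-cong γ (λ j _ → sumOn-cong α (λ k _ → sym (*-assoc _ _ _))) ⟩
      sumOn F γ (λ j → sumOn F α (λ k → M r k * N k j * x j))
        ≈⟨ sumOn-cong γ (λ j _ → sumOn-*ʳ α (x j) _) ⟨
      sumOn F γ (λ j → (M ∘[ α ] N) r j * x j) ∎

    ·-identity : ∀ (M : Mat F n) β x {r} → r ∈ β → (∀ j → j ∈ β → M r j ≈ δ F r j) →
      (M ·[ β ] x) r ≈ x r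
    ·-identity M β x {r} r∈β M≈δ = begin
      sumOn F β (λ j → M r j * x j)   ≈⟨ sumOn-cong β (λ j j∈β → *-congʳ (M≈δ j j∈β)) ⟩
      sumOn F β (λ j → δ F r j * x j) ≈⟨ sumOn-δ β x r∈β ⟩
      x r                             ∎

    InKernel-zero : ∀ β (M : Mat F n) → InKernel F β M (λ _ → 0#)
    InKernel-zero β M r _ = trans (sumOn-cong β (λ j _ → zeroʳ (M r j))) (sumOn-zero β)

    InKernel-lincomb : ∀ {m} β (M : Mat F n) (a : Fin m → Carrier) (v : Fin m → Vect F n) →
      (∀ t → InKernel F β M (v t)) → InKernel F β M (λ j → sum F (λ t → a t * v t j))
    InKernel-lincomb {m} β M a v v∈ker r r∈β = begin
      sumOn F β (λ j → M r j * sum F (λ t → a t * v t j))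
        ≈⟨ sumOn-cong β (λ j _ → sum-*ˡ (M r j) (λ t → a t * v t j)) ⟩
      sumOn F β (λ j → sum F (λ t → M r j * (a t * v t j)))
        ≈⟨ sum-sumOn-comm β (λ t j → M r j * (a t * v t j)) ⟨
      sum F (λ t → sumOn F β (λ j → M r j * (a t * v t j)))
        ≈⟨ sum-cong (λ t → trans (sumOn-cong β (λ j _ → x∙yz≈y∙xz _ _ _))
                                 (sym (sumOn-*ˡ β (a t) _))) ⟩
      sum F (λ t → a t * (M ·[ β ] v t) r)
        ≈⟨ sum-cong (λ t → trans (*-congˡ (v∈ker t r r∈β)) (zeroʳ (a t))) ⟩
      sum F {m} (λ _ → 0#)
        ≈⟨ sum-zero m ⟩
      0# ∎

  record RestrictionIso {n} (β : Subset n) (M : Mat F n) (γ : Subset n) (N : Mat F n)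
                        : Set (c ⊔ ℓ) where
    field
      γ⊆β       : γ ⊆ β
      restrict  : ∀ x → InKernel F β M x → InKernel F γ N x
      lift      : ∀ y → InKernel F γ N y →
                  ∃ λ x → InKernel F β M x × (∀ j → j ∈ γ → x j ≈ y j)
      injective : ∀ x x′ → InKernel F β M x → InKernel F β M x′ →
                  (∀ j → j ∈ γ → x j ≈ x′ j) → ∀ j → j ∈ β → x j ≈ x′ j

  module _ {n} {β γ : Subset n} {M N : Mat F n} (iso : RestrictionIso β M γ N) where
    open RestrictionIso iso

    HasNullity-restrict : ∀ k → HasNullity F β M k → HasNullity F γ N k
    HasNullity-restrict k (v , v∈ker , v-indep , v-span) =
      v , (λ t → restrict (v t) (v∈ker t)) , indep , span
      where
      indep : ∀ a → (∀ j → j ∈ γ → sum F (λ t → a t * v t j) ≈ 0#) → ∀ t → a t ≈ 0#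
      indep a av≈0 = v-indep a
        (injective _ _ (InKernel-lincomb β M a v v∈ker) (InKernel-zero β M) av≈0)

      span : ∀ y → InKernel F γ N y →
        ∃ λ a → ∀ j → j ∈ γ → y j ≈ sum F (λ t → a t * v t j)
      span y y∈ker with lift y y∈ker
      ... | x , x∈ker , x≈y with v-span x x∈ker
      ... | a , x≈av = a , λ j j∈γ → trans (sym (x≈y j j∈γ)) (x≈av j (γ⊆β j∈γ))

    HasNullity-lift : ∀ k → HasNullity F γ N k → HasNullity F β M k
    HasNullity-lift k (u , u∈ker , u-indep , u-span) =
      v , v∈ker , indep , span
      where
      v : Fin k → Vect F n
      v t = proj₁ (lift (u t) (u∈ker t))

      v∈ker : ∀ t → InKernel F β M (v t)
      v∈ker t = proj₁ (proj₂ (lift (u t) (u∈ker t)))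

      v≈u : ∀ t j → j ∈ γ → v t j ≈ u t j
      v≈u t = proj₂ (proj₂ (lift (u t) (u∈ker t)))

      av≈au : ∀ a j → j ∈ γ → sum F (λ t → a t * v t j) ≈ sum F (λ t → a t * u t j)
      av≈au a j j∈γ = sum-cong (λ t → *-congˡ (v≈u t j j∈γ))

      indep : ∀ a → (∀ j → j ∈ β → sum F (λ t → a t * v t j) ≈ 0#) → ∀ t → a t ≈ 0#
      indep a av≈0 = u-indep a (λ j j∈γ → trans (sym (av≈au a j j∈γ)) (av≈0 j (γ⊆β j∈γ)))

      span : ∀ x → InKernel F β M x →
        ∃ λ a → ∀ j → j ∈ β → x j ≈ sum F (λ t → a t * v t j)
      span x x∈ker with u-span x (restrict x x∈ker)
      ... | a , x≈au = a , injective _ _ x∈ker (InKernel-lincomb β M a v v∈ker)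
                             (λ j j∈γ → trans (x≈au j j∈γ) (sym (av≈au a j j∈γ)))

    RestrictionIso⇒HasNullity⇔ : ∀ k → HasNullity F β M k ⇔ HasNullity F γ N k
    RestrictionIso⇒HasNullity⇔ k = mk⇔ (HasNullity-restrict k) (HasNullity-lift k)

  module SchurComplement {n} {A P : Mat F n} {β α γ : Subset n}
    (β≐α⊍γ : β ≐ α ⊍ γ) (P-inv : IsInverseOfPrincipal F α A P) where

    solveα : Vect F n → Vect F n
    solveα y = P ·[ α ] A ·[ γ ] y

    solveα-kernel : ∀ x → InKernel F β A x → ∀ k → k ∈ α → solveα x k ≈ - x k
    solveα-kernel x x∈ker k k∈α = begin
      (P ·[ α ] A ·[ γ ] x) k               ≈⟨ ·-congʳ P α A·γx≈ k ⟩
      (P ·[ α ] (λ l → - (A ·[ α ] x) l)) k ≈⟨ ·-neg P α _ k ⟩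
      - (P ·[ α ] A ·[ α ] x) k             ≈⟨ -‿cong (·-assoc P A α α x k) ⟩
      - ((P ∘[ α ] A) ·[ α ] x) k           ≈⟨ -‿cong (·-identity (P ∘[ α ] A) α x k∈α
                                                 (λ j j∈α → proj₂ P-inv k j k∈α j∈α)) ⟩
      - x k                                 ∎
      where
      A·γx≈ : ∀ l → l ∈ α → (A ·[ γ ] x) l ≈ - (A ·[ α ] x) l
      A·γx≈ l l∈α = +-inverseʳ-unique _ _
        (trans (sym (sumOn-⊍ β≐α⊍γ _)) (x∈ker l (⊍-⊆ˡ β≐α⊍γ l∈α)))

    A·solveα : ∀ y {r} → r ∈ α → (A ·[ α ] solveα y) r ≈ (A ·[ γ ] y) r
    A·solveα y {r} r∈α = trans (·-assoc A P α α _ r)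
      (·-identity (A ∘[ α ] P) α _ r∈α (λ j j∈α → proj₁ P-inv r j r∈α j∈α))

    schur· : ∀ y r → (schur F α A P ·[ γ ] y) r ≈ (A ·[ γ ] y) r + - (A ·[ α ] solveα y) r
    schur· y r = begin
      sumOn F γ (λ j → (A r j + - D j) * y j)
        ≈⟨ sumOn-cong γ (λ j _ → [y-z]x≈yx-zx _ _ _) ⟩
      sumOn F γ (λ j → A r j * y j + - (D j * y j))
        ≈⟨ sumOn-+ γ _ _ ⟩
      (A ·[ γ ] y) r + sumOn F γ (λ j → - (D j * y j))
        ≈⟨ +-congˡ (sumOn-neg γ _) ⟩
      (A ·[ γ ] y) r + - sumOn F γ (λ j → D j * y j)
        ≈⟨ +-congˡ (-‿cong D·y) ⟩
      (A ·[ γ ] y) r + - (A ·[ α ] solveα y) r ∎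
      where
      D : Fin n → Carrier
      D j = sumOn F α (λ k → sumOn F α (λ l → A r k * (P k l * A l j)))

      D·y : sumOn F γ (λ j → D j * y j) ≈ (A ·[ α ] solveα y) r
      D·y = begin
        sumOn F γ (λ j → D j * y j)
          ≈⟨ sumOn-cong γ (λ j _ → *-congʳ (sumOn-cong α (λ k _ → sumOn-*ˡ α (A r k) _))) ⟨
        ((A ∘[ α ] P ∘[ α ] A) ·[ γ ] y) r ≈⟨ ·-assoc A (P ∘[ α ] A) α γ y r ⟨
        (A ·[ α ] (P ∘[ α ] A) ·[ γ ] y) r ≈⟨ ·-congʳ A α (λ k _ → ·-assoc P A α γ y k) r ⟨
        (A ·[ α ] P ·[ α ] A ·[ γ ] y) r   ∎

    extend : Vect F n → Vect F n
    extend y k = if lookup α k then - solveα y k else y k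

    extend-α : ∀ y {j} → j ∈ α → extend y j ≡ - solveα y j
    extend-α y j∈α rewrite []=⇒lookup j∈α = ≡.refl

    extend-γ : ∀ y {j} → j ∈ γ → extend y j ≡ y j
    extend-γ y j∈γ rewrite ⊍-disjoint β≐α⊍γ j∈γ = ≡.refl

    A·extend : ∀ y r → (A ·[ β ] extend y) r ≈ (A ·[ γ ] y) r + - (A ·[ α ] solveα y) r
    A·extend y r = begin
      (A ·[ β ] extend y) r
        ≈⟨ sumOn-⊍ β≐α⊍γ _ ⟩
      (A ·[ α ] extend y) r + (A ·[ γ ] extend y) r
        ≈⟨ +-cong (·-congʳ A α (λ j j∈α → reflexive (extend-α y j∈α)) r)
                  (·-congʳ A γ (λ j j∈γ → reflexive (extend-γ y j∈γ)) r) ⟩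
      (A ·[ α ] (λ j → - solveα y j)) r + (A ·[ γ ] y) r
        ≈⟨ +-congʳ (·-neg A α _ r) ⟩
      - (A ·[ α ] solveα y) r + (A ·[ γ ] y) r
        ≈⟨ +-comm _ _ ⟩
      (A ·[ γ ] y) r + - (A ·[ α ] solveα y) r ∎

    extend-kernel : ∀ y → InKernel F γ (schur F α A P) y → InKernel F β A (extend y)
    extend-kernel y y∈ker r r∈β with ⊍-∈ β≐α⊍γ r∈β
    ... | inj₁ r∈α = begin
      (A ·[ β ] extend y) r                    ≈⟨ A·extend y r ⟩
      (A ·[ γ ] y) r + - (A ·[ α ] solveα y) r ≈⟨ +-congˡ (-‿cong (A·solveα y r∈α)) ⟩
      (A ·[ γ ] y) r + - (A ·[ γ ] y) r        ≈⟨ -‿inverseʳ _ ⟩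
      0#                                       ∎
    ... | inj₂ r∈γ = trans (A·extend y r) (trans (sym (schur· y r)) (y∈ker r r∈γ))

    restrict : ∀ x → InKernel F β A x → InKernel F γ (schur F α A P) x
    restrict x x∈ker r r∈γ = begin
      (schur F α A P ·[ γ ] x) r
        ≈⟨ schur· x r ⟩
      (A ·[ γ ] x) r + - (A ·[ α ] solveα x) r
        ≈⟨ +-congˡ (-‿cong (trans (·-congʳ A α (solveα-kernel x x∈ker) r) (·-neg A α x r))) ⟩
      (A ·[ γ ] x) r + - - (A ·[ α ] x) r
        ≈⟨ +-congˡ (-‿involutive _) ⟩
      (A ·[ γ ] x) r + (A ·[ α ] x) r
        ≈⟨ +-comm _ _ ⟩
      (A ·[ α ] x) r + (A ·[ γ ] x) r
        ≈⟨ sumOn-⊍ β≐α⊍γ _ ⟨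
      (A ·[ β ] x) r
        ≈⟨ x∈ker r (⊍-⊆ʳ β≐α⊍γ r∈γ) ⟩
      0# ∎

    injective : ∀ x x′ → InKernel F β A x → InKernel F β A x′ →
                (∀ j → j ∈ γ → x j ≈ x′ j) → ∀ j → j ∈ β → x j ≈ x′ j
    injective x x′ x∈ker x′∈ker x≈x′ j j∈β with ⊍-∈ β≐α⊍γ j∈β
    ... | inj₂ j∈γ = x≈x′ j j∈γ
    ... | inj₁ j∈α = -‿injective (begin
      - x j       ≈⟨ solveα-kernel x x∈ker j j∈α ⟨
      solveα x j  ≈⟨ ·-congʳ P α (λ l _ → ·-congʳ A γ x≈x′ l) j ⟩
      solveα x′ j ≈⟨ solveα-kernel x′ x′∈ker j j∈α ⟩
      - x′ j      ∎)

    restrictionIso : RestrictionIso β A γ (schur F α A P)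
    restrictionIso = record
      { γ⊆β       = ⊍-⊆ʳ β≐α⊍γ
      ; restrict  = restrict
      ; lift      = λ y y∈ker →
          extend y , extend-kernel y y∈ker , λ j j∈γ → reflexive (extend-γ y j∈γ)
      ; injective = injective
      }

proposition5p1 : ∀ {c ℓ : Level} (F : Field c ℓ) (n : ℕ) (A : Mat F n) →
    Symmetric F A →
    (α : Subset n) (P : Mat F n) → IsInverseOfPrincipal F α A P →
    (i : Fin n) → i ∉ α →
    (∀ k → HasNullity F ⊤ A k ⇔ HasNullity F (∁ α) (schur F α A P) k) ×
    (∀ k → HasNullity F (⊤ - i) A k ⇔ HasNullity F (∁ α - i) (schur F α A P) k)
proposition5p1 F n A _ α P P-inv i i∉α =
  RestrictionIso⇒HasNullity⇔ F (restrictionIso F (⊤≐⊍∁ α) P-inv) ,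
  RestrictionIso⇒HasNullity⇔ F (restrictionIso F (⊍-remove i (⊤≐⊍∁ α) i∉α) P-inv)
  where open SchurComplement using (restrictionIso)
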